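{- In any run of the algorithm pIC3 (described in the context) on a finite symbolic DTMC $D=(\mathbf{x},I,T,P)$, a predicate $\phi$ and a threshold $y\in[0,1]$, once a frame index $k$ with $F_k=F_{k+1}$ is reached, the full set of linear equations for the upper and lower bounds $U_p(s)$, $L_p(s)$ of all danger states $s$ (i.e. constraints incorporating every transition between danger states) is obtained in finite time.
   Context: A symbolic DTMC is $D=(\mathbf{x},I,T,P)$ with $\mathbf{x}$ a finite set of Boolean state variables (states are complete assignments, finitely many), $I$ a predicate for a single initial state, $P(s,s')\in[0,1]$ transition probabilities summing to $1$ out of each state with transitions, and $T(s,s')$ true iff $P(s,s')>0$. pIC3 builds CNF frames $F_0=I$, $F_1=\phi,\dots$ by IC3-style blocking of states that can reach $\neg\phi$ (adding inductive clauses) and forward propagation of relatively inductive clauses, until $F_k=F_{k+1}$ for some $k$. Danger states are the states satisfying $\phi$ that are excluded from the frames (states that may reach $\neg\phi$); an explicit list of them is kept. For every discovered transition $(s,s')$ (each added once) the algorithm updates symbolic linear expressions $L_p(s):=L_p(s)+P(s,s')L_p(s')$ and $U_p(s):=U_p(s)-P(s,s')$, starting from $L_p(s)=1$ for $s\models\neg\phi$, and $L_p(s)=0$, $U_p(s)=1$ for $s\models\phi$. Once $F_k=F_{k+1}$, the algorithm repeatedly uses SAT calls to find a not-yet-discovered transition in $T$ between danger states and adds it to these bounds, until none remains; the full set of linear equations is the one in which all such transitions have been added, so that $L_p(s)=U_p(s)$ for every danger state.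
   Formalization: The transition probabilities $P(s,s')$ take values in the rationals in [0,1] rather than the real interval [0,1]. -}

module Defs where

open import Data.Bool using (Bool)
open import Data.Vec using (Vec)
open import Data.List using (List; _∷_)
open import Data.List.Membership.Propositional using (_∈_; _∉_)
open import Data.Product using (_×_; _,_; ∃; ∃-syntax)
open import Data.Rational using (ℚ; 0ℚ; 1ℚ; _<_; _≤_)
open import Relation.Nullary using (¬_)
open import Relation.Binary.PropositionalEquality using (_≡_)
open import Relation.Binary.Construct.Closure.ReflexiveTransitive using (Star)

-- States of a symbolic DTMC over n Boolean state variables: complete assignments.
State : (n : _) → Set
State n = Vec Bool n

Transition : (n : _) → Set
Transition n = State n × State n

ProbMatrix : (n : _) → Set
ProbMatrix n = State n → State n → ℚ

InUnitInterval : ∀ {n} → ProbMatrix n → Set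
InUnitInterval P = ∀ s s' → (0ℚ ≤ P s s') × (P s s' ≤ 1ℚ)

T : ∀ {n} → ProbMatrix n → State n → State n → Set
T P s s' = 0ℚ < P s s'

-- One iteration of the post-convergence phase of pIC3: a SAT call returns a
-- not-yet-discovered transition of T between two danger states, which is added
-- (once) to the set of discovered transitions (i.e. to the linear bounds).
data Step {n} (P : ProbMatrix n) (danger : List (State n))
          (D : List (Transition n)) : List (Transition n) → Set where
  add : ∀ s s' → s ∈ danger → s' ∈ danger → T P s s' → (s , s') ∉ D →
        Step P danger D ((s , s') ∷ D)

-- The phase stops when the SAT call finds no such transition.
Terminal : ∀ {n} → ProbMatrix n → List (State n) → List (Transition n) → Set
Terminal P danger D = ¬ (∃[ D' ] Step P danger D D')

Complete : ∀ {n} → ProbMatrix n → List (State n) → List (Transition n) → Set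
Complete P danger D =
  ∀ s s' → s ∈ danger → s' ∈ danger → T P s s' → (s , s') ∈ D

Reachable : ∀ {n} → ProbMatrix n → List (State n) →
            List (Transition n) → List (Transition n) → Set
Reachable P danger = Star (Step P danger)

-- Each step adds a fresh transition between danger states, so the number of
-- candidate pairs (danger × danger) not yet discovered strictly decreases:
-- the phase terminates. When it stops, the SAT call found no undiscovered
-- transition between danger states, which is exactly completeness.
module Submission where

open import Defs
open import Data.Nat using (ℕ)
open import Data.List using (List)
open import Data.Product using (_×_)
open import Induction.WellFounded using (Acc)

open import Data.Bool.Properties using () renaming (_≟_ to _≟ᵇ_)
open import Data.Nat using (suc; _≤_; _<_; z≤n; s≤s)
open import Data.Nat.Properties using (m≤n⇒m≤1+n; m<n⇒m<1+n)
open import Data.Nat.Induction using (<-wellFounded)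
open import Data.List using ([]; _∷_; cartesianProduct)
open import Data.List.Relation.Unary.Any using (here; there)
open import Data.List.Membership.Propositional using (_∈_; _∉_)
open import Data.List.Membership.Propositional.Properties using (∈-cartesianProduct⁺)
open import Data.List.Relation.Binary.Subset.Propositional using (_⊆_)
open import Data.List.Relation.Binary.Subset.Propositional.Properties using (xs⊆x∷xs)
import Data.List.Membership.DecPropositional as DecMembership
open import Data.Product using (_,_)
open import Data.Product.Properties using () renaming (≡-dec to ×-≡-dec)
open import Data.Vec.Properties using () renaming (≡-dec to Vec-≡-dec)
open import Function using (flip)
open import Induction.WellFounded using (WellFounded; module Subrelation)
open import Relation.Binary.Construct.On using (wellFounded)
open import Relation.Binary.Definitions using (DecidableEquality)
open import Relation.Binary.PropositionalEquality using (refl)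
open import Relation.Nullary using (yes; no)
open import Relation.Nullary.Negation using (contradiction)

module _ {a} {A : Set a} (_≟_ : DecidableEquality A) where
  open DecMembership _≟_ using (_∈?_)

  missing : List A → List A → ℕ
  missing D []       = 0
  missing D (x ∷ xs) with x ∈? D
  ... | yes _ = missing D xs
  ... | no  _ = suc (missing D xs)

  missing-antitone : ∀ {D D'} → D ⊆ D' → ∀ xs → missing D' xs ≤ missing D xs
  missing-antitone D⊆D' []       = z≤n
  missing-antitone {D} {D'} D⊆D' (x ∷ xs) with x ∈? D' | x ∈? D
  ... | yes _    | yes _   = missing-antitone D⊆D' xs
  ... | yes _    | no  _   = m≤n⇒m≤1+n (missing-antitone D⊆D' xs)
  ... | no  x∉D' | yes x∈D = contradiction (D⊆D' x∈D) x∉D'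
  ... | no  _    | no  _   = s≤s (missing-antitone D⊆D' xs)

  missing-strictly-antitone : ∀ {D D' y} → D ⊆ D' → y ∈ D' → y ∉ D →
                              ∀ xs → y ∈ xs → missing D' xs < missing D xs
  missing-strictly-antitone {D} {D'} D⊆D' y∈D' y∉D (x ∷ xs) y∈x∷xs
    with x ∈? D' | x ∈? D | y∈x∷xs
  ... | no  x∉D' | _       | here refl = contradiction y∈D' x∉D'
  ... | _        | yes x∈D | here refl = contradiction x∈D y∉D
  ... | yes _    | no  _   | here refl = s≤s (missing-antitone D⊆D' xs)
  ... | no  x∉D' | yes x∈D | there _   = contradiction (D⊆D' x∈D) x∉D'
  ... | yes _    | yes _   | there y∈xs =
    missing-strictly-antitone D⊆D' y∈D' y∉D xs y∈xs
  ... | yes _    | no  _   | there y∈xs =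
    m<n⇒m<1+n (missing-strictly-antitone D⊆D' y∈D' y∉D xs y∈xs)
  ... | no  _    | no  _   | there y∈xs =
    s≤s (missing-strictly-antitone D⊆D' y∈D' y∉D xs y∈xs)

_≟ᵗ_ : ∀ {n} → DecidableEquality (Transition n)
_≟ᵗ_ = ×-≡-dec (Vec-≡-dec _≟ᵇ_) (Vec-≡-dec _≟ᵇ_)

module _ {n} (P : ProbMatrix n) (danger : List (State n)) where

  undiscovered : List (Transition n) → ℕ
  undiscovered D = missing _≟ᵗ_ D (cartesianProduct danger danger)

  Step-decreases-undiscovered : ∀ {D D'} → Step P danger D D' →
                                undiscovered D' < undiscovered D
  Step-decreases-undiscovered (add s s' s∈ s'∈ _ new) =
    missing-strictly-antitone _≟ᵗ_ (xs⊆x∷xs _ _) (here refl) new _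
      (∈-cartesianProduct⁺ s∈ s'∈)

  Step-wellFounded : WellFounded (flip (Step P danger))
  Step-wellFounded = Subrelation.wellFounded Step-decreases-undiscovered
                       (wellFounded undiscovered <-wellFounded)

  Terminal⇒Complete : ∀ D → Terminal P danger D → Complete P danger D
  Terminal⇒Complete D terminal s s' s∈ s'∈ t with (s , s') ∈? D
    where open DecMembership _≟ᵗ_ using (_∈?_)
  ... | yes discovered = discovered
  ... | no  new        = contradiction (_ , add s s' s∈ s'∈ t new) terminal

lemma2 : (n : ℕ) (P : ProbMatrix n) → InUnitInterval P →
    (danger : List (State n)) (D₀ : List (Transition n)) →
    Acc (λ D' D → Step P danger D D') D₀ ×
    (∀ D → Reachable P danger D₀ D → Terminal P danger D → Complete P danger D)
lemma2 n P _ danger D₀ =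
  Step-wellFounded P danger D₀ , λ D _ → Terminal⇒Complete P danger D
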